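{- Let $n\geqslant 8$ and $3<m<n$. If the set $\{r_n,r_m,r_3\}$ generates $\mathrm{Sym}_n$, then $m\geqslant n-4$. Furthermore, if in addition $n$ is odd, then $m\geqslant n-3$.
   Context: $\mathrm{Sym}_n$ is the symmetric group on $\{1,\dots,n\}$. For $1< i\leqslant n$, the prefix reversal $r_i\in\mathrm{Sym}_n$ is the permutation with $r_i(j)=i+1-j$ for $1\leqslant j\leqslant i$ and $r_i(j)=j$ for $i<j\leqslant n$. -}

module Defs where

open import Data.Nat using (ℕ; zero; suc; _∸_; _≤_; _<_; s≤s; z≤n)
open import Data.Nat.Properties
  using (_<?_; ≤-trans; ≤-refl; m∸n≤m; ∸-monoʳ-<; m∸[m∸n]≡n)
open import Data.Fin using (Fin; toℕ; fromℕ<)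
open import Data.Fin.Properties using (toℕ-fromℕ<; toℕ-injective)
open import Data.Fin.Permutation
  using (Permutation′; permutation; _≈_; _∘ₚ_; flip; id)
open import Data.Sum using (_⊎_)
open import Relation.Nullary using (yes; no; contradiction)
open import Relation.Binary.PropositionalEquality
  using (_≡_; refl; sym; trans; cong)

private
  lt : ∀ {i j} → j < i → i ∸ suc j < i
  lt {suc i} {j} (s≤s j≤i) = s≤s (m∸n≤m i j)

  back : ∀ {i j} → j < i → i ∸ suc (i ∸ suc j) ≡ j
  back {suc i} {j} (s≤s j≤i) = m∸[m∸n]≡n j≤i

-- The underlying function of the prefix reversal r_i on Fin n
-- (for i ≤ n): the position j (0-based, toℕ j < i) goes to i - 1 - j,
-- positions j ≥ i are fixed.  (1-based: r_i(j) = i + 1 - j for j ≤ i.)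
revFun : ∀ {n} (i : ℕ) → i ≤ n → Fin n → Fin n
revFun i le j with toℕ j <? i
... | yes p = fromℕ< (≤-trans (lt p) le)
... | no _  = j

private
  revFun-invol : ∀ {n} (i : ℕ) (le : i ≤ n) (j : Fin n) →
                 revFun i le (revFun i le j) ≡ j
  revFun-invol i le j with toℕ j <? i
  ... | no ¬p with toℕ j <? i
  ...   | yes p = contradiction p ¬p
  ...   | no _  = refl
  revFun-invol i le j | yes p
    with toℕ (fromℕ< (≤-trans (lt p) le)) <? i
  ... | yes q = toℕ-injective
          (trans (toℕ-fromℕ< _)
            (trans (cong (λ x → i ∸ suc x) (toℕ-fromℕ< (≤-trans (lt p) le)))
                   (back p)))
  ... | no ¬q = contradiction
          (Data.Nat.Properties.≤-trans
            (Data.Nat.Properties.≤-reflexive (cong suc (toℕ-fromℕ< _))) (lt p)) ¬q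

r : ∀ {n} (i : ℕ) → i ≤ n → Permutation′ n
r i le = permutation (revFun i le) (revFun i le)
                     (revFun-invol i le) (revFun-invol i le)

data ⟨_⟩ {n} (S : Permutation′ n → Set) : Permutation′ n → Set where
  gen  : ∀ {π} → S π → ⟨ S ⟩ π
  one  : ⟨ S ⟩ id
  comp : ∀ {π ρ} → ⟨ S ⟩ π → ⟨ S ⟩ ρ → ⟨ S ⟩ (π ∘ₚ ρ)
  inv  : ∀ {π} → ⟨ S ⟩ π → ⟨ S ⟩ (flip π)
  resp : ∀ {π ρ} → π ≈ ρ → ⟨ S ⟩ π → ⟨ S ⟩ ρ

Generates : ∀ {n} → (Permutation′ n → Set) → Set
Generates S = ∀ π → ⟨ S ⟩ π

｛_,_,_｝ : ∀ {n} → Permutation′ n → Permutation′ n → Permutation′ n →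
          Permutation′ n → Set
｛ a , b , c ｝ π = π ≈ a ⊎ π ≈ b ⊎ π ≈ c

{-# OPTIONS --safe #-}
-- Number positions from 0 and let d = n − m.  Since n ≡ m (mod d), the reversals r_n and
-- r_m both act on residues mod d as x ↦ m − 1 − x, while r_3 only swaps the positions 0
-- and 2.  Hence the positions whose residue lies in {0, 2, m − 1, m − 3} form a set that
-- is invariant under ⟨r_n, r_m, r_3⟩ and contains 0; if that group is all of Sym_n it is
-- transitive, so every position lies in the set.  For d ≥ 5 the positions 3 and 4 cannot
-- both do so, and for d = 4 with n (hence m) odd all four residues are even, excluding 1.
module Submission where

open import Defs
open import Data.Nat as ℕ using (ℕ; suc; _∸_; _≤_; _<_; _≤ᵇ_; z≤n; s≤s; NonZero)
open import Data.Nat.Properties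
  using (≤-refl; <⇒≤; <-trans; ≤-<-trans; _<?_; ≤ᵇ⇒≤; <⇒≱; ≮⇒≥;
         ≤-pred; m≤n⇒m<n∨m≡n; m≤n+o⇒m∸n≤o; m≤n+m∸n; +-comm; +-monoʳ-≤;
         module ≤-Reasoning)
open import Data.Nat.DivMod using (_%_; _/_; m≡m%n+[m/n]*n)
open import Data.Nat.Divisibility using (∣⇒≤)
open import Data.Integer as ℤ using (ℤ; +_; 0ℤ; 1ℤ; _+_; _-_; _*_)
import Data.Integer.Properties as ℤ
open import Data.Integer.Divisibility.Signed
  using (_∣_; divides; ∣⇒∣ᵤ; ∣-refl; ∣-trans; ∣m∣n⇒∣m+n; ∣m∣n⇒∣m-n)
open import Data.Integer.Tactic.RingSolver using (solve-∀)
open import Data.Fin using (Fin; toℕ; fromℕ<)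
open import Data.Fin.Properties using (toℕ-fromℕ<; _≟_)
open import Data.Fin.Permutation
  using (Permutation′; _⟨$⟩ʳ_; _⟨$⟩ˡ_; _≈_; _∘ₚ_; flip; inverseˡ; inverseʳ; transpose)
open import Data.Product using (_×_; _,_)
open import Data.Sum using (_⊎_; inj₁; inj₂)
open import Data.Empty using (⊥; ⊥-elim)
open import Data.Bool using (T)
open import Function using (_∘_)
open import Function.Bundles using (_⇔_; mk⇔; Equivalence)
open import Function.Construct.Identity using (⇔-id)
open import Function.Construct.Composition using (_⇔-∘_)
open import Function.Construct.Symmetry using (⇔-sym)
open import Relation.Nullary using (¬_; yes; no)
open import Relation.Nullary.Decidable using (dec-true)
open import Relation.Binary.PropositionalEquality
  using (_≡_; refl; sym; trans; cong; subst; module ≡-Reasoning)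

transpose-applyˡ : ∀ {n} (i j : Fin n) → transpose i j ⟨$⟩ʳ i ≡ j
transpose-applyˡ i j rewrite dec-true (i ≟ i) refl = refl

module _ {n : ℕ} (X : Fin n → Set) where

  Invariant : Permutation′ n → Set
  Invariant π = ∀ j → X j ⇔ X (π ⟨$⟩ʳ j)

  preserved⇒invariant : ∀ π → (∀ j → X j → X (π ⟨$⟩ʳ j)) →
                        (∀ j → X j → X (π ⟨$⟩ˡ j)) → Invariant π
  preserved⇒invariant π to from j =
    mk⇔ (to j) (λ x → subst X (inverseˡ π) (from (π ⟨$⟩ʳ j) x))

  Invariant-resp : ∀ {π ρ} → π ≈ ρ → Invariant π → Invariant ρ
  Invariant-resp π≈ρ invπ j = subst (λ k → X j ⇔ X k) (π≈ρ j) (invπ j)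

  Invariant-flip : ∀ {π} → Invariant π → Invariant (flip π)
  Invariant-flip {π} invπ j =
    ⇔-sym (subst (λ k → X (π ⟨$⟩ˡ j) ⇔ X k) (inverseʳ π) (invπ (π ⟨$⟩ˡ j)))

  Invariant-∘ : ∀ {π ρ} → Invariant π → Invariant ρ → Invariant (π ∘ₚ ρ)
  Invariant-∘ {π} invπ invρ j = invρ (π ⟨$⟩ʳ j) ⇔-∘ invπ j

  ⟨⟩-invariant : ∀ {S} → (∀ π → S π → Invariant π) → ∀ {π} → ⟨ S ⟩ π → Invariant π
  ⟨⟩-invariant invS (gen {π} s)   = invS π s
  ⟨⟩-invariant invS one           = λ j → ⇔-id (X j)
  ⟨⟩-invariant invS (comp {π} {ρ} p q) =
    Invariant-∘ {π} {ρ} (⟨⟩-invariant invS p) (⟨⟩-invariant invS q)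
  ⟨⟩-invariant invS (inv {π} p) = Invariant-flip {π} (⟨⟩-invariant invS p)
  ⟨⟩-invariant invS (resp {π} {ρ} π≈ρ p) =
    Invariant-resp {π} {ρ} π≈ρ (⟨⟩-invariant invS p)

  generates⇒invariant-total : ∀ {S} → Generates S → (∀ π → S π → Invariant π) →
                              ∀ i j → X i → X j
  generates⇒invariant-total gens invS i j Xi =
    subst X (transpose-applyˡ i j)
      (Equivalence.to (⟨⟩-invariant invS (gens (transpose i j)) i) Xi)

prefix-reversal-invariant : ∀ {n} (P : ℕ → Set) i (i≤n : i ≤ n) →
  (∀ x → x < i → P x → P (i ∸ suc x)) → Invariant (P ∘ toℕ) (r i i≤n)
prefix-reversal-invariant P i i≤n mirrorP =
  preserved⇒invariant (P ∘ toℕ) (r i i≤n) preserves preserves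
  where
  preserves : ∀ j → P (toℕ j) → P (toℕ (revFun i i≤n j))
  preserves j Pj with toℕ j <? i
  ... | yes j<i = subst P (sym (toℕ-fromℕ< _)) (mirrorP (toℕ j) j<i Pj)
  ... | no _    = Pj

pos-∸ : ∀ {m n} → m ≤ n → + (n ∸ m) ≡ + n - + m
pos-∸ {m} {n} m≤n = sym (trans (ℤ.[+m]-[+n]≡m⊖n n m) (ℤ.⊖-≥ m≤n))

∤-small : ∀ {d} z .{{_ : NonZero ℤ.∣ z ∣}} → ℤ.∣ z ∣ < d → ¬ (+ d ∣ z)
∤-small z z<d d∣z = <⇒≱ z<d (∣⇒≤ (∣⇒∣ᵤ d∣z))

module Residues (d : ℕ) (c : ℤ) where

  -- a record rather than an abbreviation, so that its two indices can be inferred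
  infix 4 _≋_
  record _≋_ (x y : ℤ) : Set where
    constructor congruent
    field d∣x-y : + d ∣ x - y

  ≋-refl : ∀ {x} → x ≋ x
  ≋-refl {x} = congruent (subst (+ d ∣_) (sym (ℤ.+-inverseʳ x)) (divides 0ℤ refl))

  ≋-sub : ∀ {x y u v} → x ≋ y → u ≋ v → x - u ≋ y - v
  ≋-sub {x} {y} {u} {v} (congruent x≋y) (congruent u≋v) =
    congruent (subst (+ d ∣_) (regroup x y u v) (∣m∣n⇒∣m-n x≋y u≋v))
    where
    regroup : ∀ x y u v → (x - y) - (u - v) ≡ (x - u) - (y - v)
    regroup = solve-∀

  ∣-resp-≋ : ∀ {k x y} → k ∣ + d → x ≋ y → k ∣ y → k ∣ x
  ∣-resp-≋ {k} {x} {y} k∣d (congruent x≋y) k∣y =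
    subst (k ∣_) (cancel x y) (∣m∣n⇒∣m+n (∣-trans k∣d x≋y) k∣y)
    where
    cancel : ∀ x y → (x - y) + y ≡ x
    cancel = solve-∀

  mirror : ℤ → ℤ → ℤ
  mirror i x = i - (1ℤ + x)

  mirror-involutive : ∀ i x → mirror i (mirror i x) ≡ x
  mirror-involutive = identity
    where
    identity : ∀ i x → i - (1ℤ + (i - (1ℤ + x))) ≡ x
    identity = solve-∀

  ≋-mirror : ∀ {i j x y} → i ≋ j → x ≋ y → mirror i x ≋ mirror j y
  ≋-mirror {i} {j} {x} {y} (congruent i≋j) (congruent x≋y) =
    congruent (subst (+ d ∣_) (regroup i j x y) (∣m∣n⇒∣m-n i≋j x≋y))
    where
    regroup : ∀ i j x y → (i - j) - (x - y) ≡ (i - (1ℤ + x)) - (j - (1ℤ + y))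
    regroup = solve-∀

  Special : ℤ → Set
  Special x = x ≋ 0ℤ ⊎ x ≋ + 2 ⊎ x ≋ mirror c 0ℤ ⊎ x ≋ mirror c (+ 2)

  Special-mirror : ∀ {i x} → i ≋ c → Special x → Special (mirror i x)
  Special-mirror i≋c (inj₁ x≋0) = inj₂ (inj₂ (inj₁ (≋-mirror i≋c x≋0)))
  Special-mirror i≋c (inj₂ (inj₁ x≋2)) = inj₂ (inj₂ (inj₂ (≋-mirror i≋c x≋2)))
  Special-mirror {i} {x} i≋c (inj₂ (inj₂ (inj₁ x≋c₀))) =
    inj₁ (subst (mirror i x ≋_) (mirror-involutive c 0ℤ) (≋-mirror i≋c x≋c₀))
  Special-mirror {i} {x} i≋c (inj₂ (inj₂ (inj₂ x≋c₂))) =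
    inj₂ (inj₁ (subst (mirror i x ≋_) (mirror-involutive c (+ 2)) (≋-mirror i≋c x≋c₂)))

  mirror-difference : ∀ a b → mirror c b - mirror c a ≡ a - b
  mirror-difference = identity c
    where
    identity : ∀ c a b → (c - (1ℤ + b)) - (c - (1ℤ + a)) ≡ a - b
    identity = solve-∀

  Special-3-4⇒d≤4 : Special (+ 3) → Special (+ 4) → d ≤ 4
  Special-3-4⇒d≤4 s₃ s₄ = ≮⇒≥ (λ 4<d → absurd 4<d s₃ s₄)
    where
    opposite : ∀ a b → + 3 ≋ mirror c a → + 4 ≋ mirror c b → + 1 ≋ a - b
    opposite a b h₃ h₄ = subst (+ 1 ≋_) (mirror-difference a b) (≋-sub h₄ h₃)

    absurd : 4 < d → Special (+ 3) → Special (+ 4) → ⊥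
    absurd 4<d = both
      where
      -- the bound on the (literal) difference x − y is discharged by evaluation
      ≉-small : ∀ {x y} .{{_ : NonZero ℤ.∣ x - y ∣}} {_ : T (ℤ.∣ x - y ∣ ≤ᵇ 4)} →
                ¬ (x ≋ y)
      ≉-small {x} {y} {≤4} (congruent d∣x-y) =
        ∤-small (x - y) (≤-<-trans (≤ᵇ⇒≤ _ 4 ≤4) 4<d) d∣x-y

      both : Special (+ 3) → Special (+ 4) → ⊥
      both (inj₁ h₃)        _ = ≉-small h₃
      both (inj₂ (inj₁ h₃)) _ = ≉-small h₃
      both _ (inj₁ h₄)        = ≉-small h₄
      both _ (inj₂ (inj₁ h₄)) = ≉-small h₄
      both (inj₂ (inj₂ (inj₁ h₃))) (inj₂ (inj₂ (inj₁ h₄))) = ≉-small (opposite 0ℤ 0ℤ h₃ h₄)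
      both (inj₂ (inj₂ (inj₁ h₃))) (inj₂ (inj₂ (inj₂ h₄))) = ≉-small (opposite 0ℤ (+ 2) h₃ h₄)
      both (inj₂ (inj₂ (inj₂ h₃))) (inj₂ (inj₂ (inj₁ h₄))) = ≉-small (opposite (+ 2) 0ℤ h₃ h₄)
      both (inj₂ (inj₂ (inj₂ h₃))) (inj₂ (inj₂ (inj₂ h₄))) = ≉-small (opposite (+ 2) (+ 2) h₃ h₄)

  Special-even : + 2 ∣ + d → + 2 ∣ mirror c 0ℤ → ∀ {x} → Special x → + 2 ∣ x
  Special-even 2∣d 2∣c₀ (inj₁ h)               = ∣-resp-≋ 2∣d h (divides 0ℤ refl)
  Special-even 2∣d 2∣c₀ (inj₂ (inj₁ h))        = ∣-resp-≋ 2∣d h (divides 1ℤ refl)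
  Special-even 2∣d 2∣c₀ (inj₂ (inj₂ (inj₁ h))) = ∣-resp-≋ 2∣d h 2∣c₀
  Special-even 2∣d 2∣c₀ (inj₂ (inj₂ (inj₂ h))) = ∣-resp-≋ 2∣d h 2∣c₂
    where
    shift : ∀ c → (c - 1ℤ) - + 2 ≡ c - + 3
    shift = solve-∀
    2∣c₂ : + 2 ∣ mirror c (+ 2)
    2∣c₂ = subst (+ 2 ∣_) (shift c) (∣m∣n⇒∣m-n 2∣c₀ (divides 1ℤ refl))

odd⇒2∣pred : ∀ n → n % 2 ≡ 1 → + 2 ∣ + n - 1ℤ
odd⇒2∣pred n odd = divides (+ (n / 2)) (begin
  + n - 1ℤ                            ≡⟨ cong (λ k → + k - 1ℤ) (m≡m%n+[m/n]*n n 2) ⟩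
  + (n % 2 ℕ.+ n / 2 ℕ.* 2) - 1ℤ      ≡⟨ cong (λ k → + (k ℕ.+ n / 2 ℕ.* 2) - 1ℤ) odd ⟩
  (1ℤ + + (n / 2 ℕ.* 2)) - 1ℤ         ≡⟨ cancel (+ (n / 2 ℕ.* 2)) ⟩
  + (n / 2 ℕ.* 2)                     ≡⟨ ℤ.pos-* (n / 2) 2 ⟩
  + (n / 2) * + 2                     ∎)
  where
  open ≡-Reasoning
  cancel : ∀ k → (1ℤ + k) - 1ℤ ≡ k
  cancel = solve-∀

∣pred-∸ : ∀ {k m n} → m ≤ n → k ∣ + n - 1ℤ → k ∣ + (n ∸ m) → k ∣ + m - 1ℤ
∣pred-∸ {k} {m} {n} m≤n k∣n-1 k∣n∸m = subst (k ∣_) (shift (+ n) (+ m))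
  (∣m∣n⇒∣m-n k∣n-1 (subst (k ∣_) (pos-∸ m≤n) k∣n∸m))
  where
  shift : ∀ n m → (n - 1ℤ) - (n - m) ≡ m - 1ℤ
  shift = solve-∀

m∸n≤o⇒m∸o≤n : ∀ n m k → n ∸ m ≤ k → n ∸ k ≤ m
m∸n≤o⇒m∸o≤n n m k n∸m≤k = m≤n+o⇒m∸n≤o n k (begin
  n             ≤⟨ m≤n+m∸n n m ⟩
  m ℕ.+ (n ∸ m) ≤⟨ +-monoʳ-≤ m n∸m≤k ⟩
  m ℕ.+ k       ≡⟨ +-comm m k ⟩
  k ℕ.+ m       ∎)
  where open ≤-Reasoning

reversals-generate⇒Special : ∀ {n m} (3<m : 3 < m) (m<n : m < n) →
  Generates ｛ r n ≤-refl , r m (<⇒≤ m<n) , r 3 (<⇒≤ (<-trans 3<m m<n)) ｝ →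
  ∀ y → y < n → Residues.Special (n ∸ m) (+ m) (+ y)
reversals-generate⇒Special {n} {m} 3<m m<n gens y y<n =
  subst P (toℕ-fromℕ< y<n)
    (generates⇒invariant-total (P ∘ toℕ) gens generators-invariant
      (fromℕ< 0<n) (fromℕ< y<n) (subst P (sym (toℕ-fromℕ< 0<n)) (inj₁ ≋-refl)))
  where
  open Residues (n ∸ m) (+ m)

  P : ℕ → Set
  P x = Special (+ x)

  0<n : 0 < n
  0<n = ≤-<-trans z≤n m<n

  n≋m : + n ≋ + m
  n≋m = congruent (subst (+ (n ∸ m) ∣_) (pos-∸ (<⇒≤ m<n)) ∣-refl)

  reversal-invariant : ∀ i (i≤n : i ≤ n) → + i ≋ + m → Invariant (P ∘ toℕ) (r i i≤n)
  reversal-invariant i i≤n i≋m = prefix-reversal-invariant P i i≤n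
    (λ x x<i Px → subst Special (sym (pos-∸ x<i)) (Special-mirror i≋m Px))

  r₃-mirror : ∀ x → x < 3 → P x → P (2 ∸ x)
  r₃-mirror 0 _ _  = inj₂ (inj₁ ≋-refl)
  r₃-mirror 1 _ P₁ = P₁
  r₃-mirror 2 _ _  = inj₁ ≋-refl
  r₃-mirror (suc (suc (suc _))) (s≤s (s≤s (s≤s ())))

  generators-invariant : ∀ π →
    ｛ r n ≤-refl , r m (<⇒≤ m<n) , r 3 (<⇒≤ (<-trans 3<m m<n)) ｝ π → Invariant (P ∘ toℕ) π
  generators-invariant π (inj₁ π≈rₙ) =
    Invariant-resp (P ∘ toℕ) {r n ≤-refl} {π} (λ j → sym (π≈rₙ j))
      (reversal-invariant n ≤-refl n≋m)
  generators-invariant π (inj₂ (inj₁ π≈rₘ)) =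
    Invariant-resp (P ∘ toℕ) {r m (<⇒≤ m<n)} {π} (λ j → sym (π≈rₘ j))
      (reversal-invariant m (<⇒≤ m<n) ≋-refl)
  generators-invariant π (inj₂ (inj₂ π≈r₃)) =
    Invariant-resp (P ∘ toℕ) {r 3 _} {π} (λ j → sym (π≈r₃ j))
      (prefix-reversal-invariant P 3 (<⇒≤ (<-trans 3<m m<n)) r₃-mirror)

lemma6 : (n m : ℕ) → 8 ≤ n → (3<m : 3 < m) → (m<n : m < n) →
    Generates ｛ r n ≤-refl , r m (<⇒≤ m<n) , r 3 (<⇒≤ (<-trans 3<m m<n)) ｝ →
    (n ∸ 4 ≤ m) × (n % 2 ≡ 1 → n ∸ 3 ≤ m)
lemma6 n m _ 3<m m<n gens = m∸n≤o⇒m∸o≤n n m 4 d≤4 , odd⇒n∸3≤m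
  where
  open Residues (n ∸ m) (+ m)

  special : ∀ y → y < n → Special (+ y)
  special = reversals-generate⇒Special 3<m m<n gens

  3<n : 3 < n
  3<n = <-trans 3<m m<n

  d≤4 : n ∸ m ≤ 4
  d≤4 = Special-3-4⇒d≤4 (special 3 3<n) (special 4 (≤-<-trans 3<m m<n))

  odd⇒n∸3≤m : n % 2 ≡ 1 → n ∸ 3 ≤ m
  odd⇒n∸3≤m odd with m≤n⇒m<n∨m≡n d≤4
  ... | inj₁ d<4 = m∸n≤o⇒m∸o≤n n m 3 (≤-pred d<4)
  ... | inj₂ d≡4 = ⊥-elim (∤-small 1ℤ ≤-refl (Special-even 2∣d (∣pred-∸ (<⇒≤ m<n) (odd⇒2∣pred n odd) 2∣d) (special 1 1<n)))
    where
    1<n : 1 < n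
    1<n = <-trans (s≤s (s≤s z≤n)) 3<n
    2∣d : + 2 ∣ + (n ∸ m)
    2∣d = subst (λ k → + 2 ∣ + k) (sym d≡4) (divides (+ 2) refl)
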